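{- Let $G$ be a finite graph and $k\ge 1$ an integer. Let $M\subseteq V(G)$ be a maximal $(k+1)$-chromatic subset of $V(G)$, and let $(S,I)$ be a partition of $M$ into a set $S$ with $\chi(S)=k$ and an independent set $I$, chosen so that $|S|$ is maximum among all such partitions of $M$. Then $I$ is a maximal independent subset of $V(G)\setminus S$ with $|I|\le |S|/k$, and $S$ is a maximal $k$-chromatic subset of $V(G)$.
   Context: For a vertex set $S\subseteq V(G)$, $\chi(S)$ is the chromatic number of the subgraph of $G$ induced by $S$. A set $S$ is a maximal $k$-chromatic subset of $T$ if $S\subseteq T$, $\chi(S)=k$, and $\chi(S')>k$ for every $S'$ with $S\subsetneq S'\subseteq T$. For $k=1$ this is a maximal independent subset of $T$ (a set of pairwise nonadjacent vertices of $T$ not properly contained in another such set). -}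

module Defs where

open import Data.Nat using (ℕ; _≤_; _<_)
open import Data.Fin using (Fin)
open import Data.Fin.Subset using (Subset; _∈_; _⊆_; _⊂_; _∪_; _∩_; Empty)
open import Data.Product using (Σ; ∃; ∃-syntax; _×_)
open import Relation.Nullary using (¬_)
open import Relation.Binary.PropositionalEquality using (_≡_)
open import Relation.Binary using (Decidable)

record Graph (n : ℕ) : Set₁ where
  field
    Adj     : Fin n → Fin n → Set
    adj?    : Decidable Adj
    sym     : ∀ {u v} → Adj u v → Adj v u
    irrefl  : ∀ {v} → ¬ Adj v v

open Graph public

module _ {n : ℕ} (G : Graph n) where

  Colorable : Subset n → ℕ → Set
  Colorable S k =
    Σ ((v : Fin n) → v ∈ S → Fin k) λ c →
      ∀ {u v} (hu : u ∈ S) (hv : v ∈ S) → Adj G u v → ¬ (c u hu ≡ c v hv)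

  ChromNum : Subset n → ℕ → Set
  ChromNum S k = Colorable S k × (∀ m → Colorable S m → k ≤ m)

  ChromGt : Subset n → ℕ → Set
  ChromGt S k = ∃[ m ] (ChromNum S m × k < m)

  MaxChromSubset : ℕ → Subset n → Subset n → Set
  MaxChromSubset k S T =
    S ⊆ T × ChromNum S k × (∀ S′ → S ⊂ S′ → S′ ⊆ T → ChromGt S′ k)

  Independent : Subset n → Set
  Independent S = ∀ {u v} → u ∈ S → v ∈ S → ¬ Adj G u v

  MaxIndepSubset : Subset n → Subset n → Set
  MaxIndepSubset I T =
    I ⊆ T × Independent I × (∀ J → I ⊂ J → J ⊆ T → ¬ Independent J)

  GoodPartition : ℕ → Subset n → Subset n → Subset n → Set
  GoodPartition k M S I =
    S ∪ I ≡ M × Empty (S ∩ I) × ChromNum S k × Independent I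

{-# OPTIONS --safe #-}
module Submission where

-- Fix a proper k-colouring of S and let C be one of its colour classes. Exchanging C and I
-- gives another admissible partition of M: (S ─ C) ∪ I is k-colourable, I taking over the
-- colour of C, and it needs k colours since adding the independent set C back yields M.
-- Maximality of ∣ S ∣ thus gives ∣ I ∣ ≤ ∣ C ∣ for each of the k classes, and summing over
-- the classes gives k ∣ I ∣ ≤ ∣ S ∣. The maximality claims are exchange arguments of the
-- same kind: a vertex that could join I outside S, or join S outside I, would give a proper
-- superset of M that is still (k + 1)-colourable; a vertex of I that could join S would give
-- an admissible partition with a larger chromatic part.

open import Defs
open import Data.Nat using (ℕ; _≤_; _*_; _+_)
open import Data.Fin.Subset using (Subset; ∁; ∣_∣; ⊤)
open import Data.Product using (_×_)

open import Data.Fin using (Fin; zero; suc; inject≤; finToFun; funToFin)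
open import Data.Fin.Properties
  using (_≟_; suc-injective; ¬Fin0; all?; any?; inject≤-injective; finToFun-funToFin)
open import Data.Fin.Subset
  using (_∈_; _∉_; _⊆_; _⊂_; _∪_; _∩_; _─_; _-_; ⁅_⁆; Empty; inside; outside)
open import Data.Fin.Subset.Properties
  using ( _∈?_; nonempty?; drop-∷-Empty; ⊆-refl; ⊆-antisym; ⊆⊤; p⊂q⇒∣p∣<∣q∣
        ; x∈p∪q⁺; x∈p∪q⁻; x∈p∩q⁺; x∈p∩q⁻; p∩q⊆p; p⊆p∪q; ∪-assoc; ∪-comm
        ; x∈p∧x∉q⇒x∈p─q; p─q⊆p; x∈⁅x⁆; x∈⁅y⁆⇒x≡y; x∉p⇒x∈∁p; x∈∁p⇒x∉p )
open import Data.Nat using (zero; suc; _<_; z≤n)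
open import Data.Nat.Induction using (<-wellFounded)
open import Data.Nat.Properties
  using ( +-suc; +-comm; +-mono-≤; +-cancelˡ-≤; ≤-pred; <⇒≱; ≮⇒≥; ≰⇒>; anyUpTo?
        ; +-0-commutativeMonoid; module ≤-Reasoning )
open import Algebra.Properties.CommutativeMonoid.Sum +-0-commutativeMonoid
  using (sum-syntax; sum-replicate-zero)
open import Data.Product using (∃; _,_; proj₁; proj₂)
open import Data.Sum as Sum using (inj₁; inj₂; [_,_]′)
open import Data.Vec using (_∷_; []; tabulate; here; there)
open import Data.Vec.Properties using (lookup∘tabulate; lookup⇒[]=; []=⇒lookup)
open import Function using (_∘_)
open import Induction.WellFounded using (Acc; acc)
open import Relation.Nullary using (¬_; Dec; yes; no; does; contradiction)
open import Relation.Nullary.Decidable using (map′; dec-true; _→-dec_; ¬?)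
open import Relation.Unary as U using (Pred)
open import Relation.Binary.PropositionalEquality as ≡
  using (_≡_; _≢_; _≗_; refl; trans; cong; subst)

module _ {p} {P : Pred ℕ p} (P? : U.Decidable P) where

  least : ∀ {m} → P m → ∃ λ m → P m × (∀ m′ → P m′ → m ≤ m′)
  least {m} = search m (<-wellFounded m)
    where
    search : ∀ m → Acc _<_ m → P m → ∃ λ m → P m × (∀ m′ → P m′ → m ≤ m′)
    search m (acc rs) Pm with anyUpTo? P? m
    ... | yes (m′ , m′<m , Pm′) = search m′ (rs m′<m) Pm′
    ... | no ¬smaller = m , Pm , λ m′ Pm′ → ≮⇒≥ λ m′<m → ¬smaller (m′ , m′<m , Pm′)

x∈p─q⇒x∉q : ∀ {n} {p q : Subset n} {x} → x ∈ p ─ q → x ∉ q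
x∈p─q⇒x∉q {p = _ ∷ p} {_ ∷ q} () here
x∈p─q⇒x∉q {p = _ ∷ p} {_ ∷ q} (there x∈p─q) (there x∈q) = x∈p─q⇒x∉q x∈p─q x∈q

module _ {n : ℕ} where

  p─q∪q≡p : ∀ {p q : Subset n} → q ⊆ p → (p ─ q) ∪ q ≡ p
  p─q∪q≡p {p} {q} q⊆p = ⊆-antisym ⊆p ⊇p
    where
    ⊆p : (p ─ q) ∪ q ⊆ p
    ⊆p x∈ = [ p─q⊆p p q , q⊆p ]′ (x∈p∪q⁻ (p ─ q) q x∈)
    ⊇p : p ⊆ (p ─ q) ∪ q
    ⊇p {x} x∈p with x ∈? q
    ... | yes x∈q = x∈p∪q⁺ (inj₂ x∈q)
    ... | no x∉q = x∈p∪q⁺ (inj₁ (x∈p∧x∉q⇒x∈p─q x∈p x∉q))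

  Empty[p─q∩q] : ∀ (p q : Subset n) → Empty ((p ─ q) ∩ q)
  Empty[p─q∩q] p q (x , x∈) with x∈p∩q⁻ (p ─ q) q x∈
  ... | x∈p─q , x∈q = x∈p─q⇒x∉q x∈p─q x∈q

  ∪-⊂-∪ : ∀ {p q r s : Subset n} {x} → p ⊆ q → r ⊆ s →
          x ∈ q ∪ s → x ∉ p → x ∉ r → p ∪ r ⊂ q ∪ s
  ∪-⊂-∪ {p} {q} {r} {s} p⊆q r⊆s x∈ x∉p x∉r =
    (x∈p∪q⁺ ∘ Sum.map p⊆q r⊆s ∘ x∈p∪q⁻ p r) , _ , x∈ , [ x∉p , x∉r ]′ ∘ x∈p∪q⁻ p r

∣p∪q∣≡∣p∣+∣q∣ : ∀ {n} (p q : Subset n) → Empty (p ∩ q) → ∣ p ∪ q ∣ ≡ ∣ p ∣ + ∣ q ∣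
∣p∪q∣≡∣p∣+∣q∣ []            []            _ = refl
∣p∪q∣≡∣p∣+∣q∣ (inside  ∷ p) (inside  ∷ q) e = contradiction (zero , here) e
∣p∪q∣≡∣p∣+∣q∣ (inside  ∷ p) (outside ∷ q) e = cong suc (∣p∪q∣≡∣p∣+∣q∣ p q (drop-∷-Empty e))
∣p∪q∣≡∣p∣+∣q∣ (outside ∷ p) (inside  ∷ q) e =
  trans (cong suc (∣p∪q∣≡∣p∣+∣q∣ p q (drop-∷-Empty e))) (≡.sym (+-suc ∣ p ∣ ∣ q ∣))
∣p∪q∣≡∣p∣+∣q∣ (outside ∷ p) (outside ∷ q) e = ∣p∪q∣≡∣p∣+∣q∣ p q (drop-∷-Empty e)

∣p─q∣+∣q∣≡∣p∣ : ∀ {n} {p q : Subset n} → q ⊆ p → ∣ p ─ q ∣ + ∣ q ∣ ≡ ∣ p ∣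
∣p─q∣+∣q∣≡∣p∣ {p = p} {q} q⊆p =
  trans (≡.sym (∣p∪q∣≡∣p∣+∣q∣ (p ─ q) q (Empty[p─q∩q] p q))) (cong ∣_∣ (p─q∪q≡p q⊆p))

_⁻¹[_] : ∀ {n k} → (Fin n → Fin k) → Fin k → Subset n
c ⁻¹[ j ] = tabulate λ v → does (c v ≟ j)

module _ {n k} {c : Fin n → Fin k} {j : Fin k} {x : Fin n} where

  x∈c⁻¹[j]⇒cx≡j : x ∈ c ⁻¹[ j ] → c x ≡ j
  x∈c⁻¹[j]⇒cx≡j x∈ with c x ≟ j | trans (≡.sym (lookup∘tabulate _ x)) ([]=⇒lookup x∈)
  ... | yes cx≡j | _  = cx≡j
  ... | no _     | ()

  cx≡j⇒x∈c⁻¹[j] : c x ≡ j → x ∈ c ⁻¹[ j ]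
  cx≡j⇒x∈c⁻¹[j] cx≡j = lookup⇒[]= x _ (trans (lookup∘tabulate _ x) (dec-true (c x ≟ j) cx≡j))

∑∣δ∷q∣≡1+∑∣q∣ : ∀ {n k} (i : Fin k) (q : Fin k → Subset n) →
                ∑[ j < k ] ∣ does (i ≟ j) ∷ q j ∣ ≡ suc (∑[ j < k ] ∣ q j ∣)
∑∣δ∷q∣≡1+∑∣q∣ zero    q = refl
∑∣δ∷q∣≡1+∑∣q∣ (suc i) q =
  trans (cong (∣ q zero ∣ +_) (∑∣δ∷q∣≡1+∑∣q∣ i (q ∘ suc))) (+-suc ∣ q zero ∣ _)

∣p∣≡∑∣p∩c⁻¹[j]∣ : ∀ {n k} (p : Subset n) (c : Fin n → Fin k) →
                  ∣ p ∣ ≡ ∑[ j < k ] ∣ p ∩ c ⁻¹[ j ] ∣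
∣p∣≡∑∣p∩c⁻¹[j]∣ {k = k} []            c = ≡.sym (sum-replicate-zero k)
∣p∣≡∑∣p∩c⁻¹[j]∣         (outside ∷ p) c = ∣p∣≡∑∣p∩c⁻¹[j]∣ p (c ∘ suc)
∣p∣≡∑∣p∩c⁻¹[j]∣         (inside  ∷ p) c =
  trans (cong suc (∣p∣≡∑∣p∩c⁻¹[j]∣ p (c ∘ suc)))
        (≡.sym (∑∣δ∷q∣≡1+∑∣q∣ (c zero) (λ j → p ∩ (c ∘ suc) ⁻¹[ j ])))

*≤∑ : ∀ {k a} (f : Fin k → ℕ) → (∀ j → a ≤ f j) → k * a ≤ ∑[ j < k ] f j
*≤∑ {zero}  f a≤f = z≤n
*≤∑ {suc k} f a≤f = +-mono-≤ (a≤f zero) (*≤∑ (f ∘ suc) (a≤f ∘ suc))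

module _ {n : ℕ} (G : Graph n) where

  Proper : ∀ {m} → Subset n → (Fin n → Fin m) → Set
  Proper T c = ∀ u v → u ∈ T → v ∈ T → Adj G u v → c u ≢ c v

  proper? : ∀ {m} T (c : Fin n → Fin m) → Dec (Proper T c)
  proper? T c = all? λ u → all? λ v →
    u ∈? T →-dec v ∈? T →-dec adj? G u v →-dec ¬? (c u ≟ c v)

  Proper-cong : ∀ {m T} {c d : Fin n → Fin m} → c ≗ d → Proper T c → Proper T d
  Proper-cong c≗d proper u v u∈T v∈T uv du≡dv =
    proper u v u∈T v∈T uv (trans (c≗d u) (trans du≡dv (≡.sym (c≗d v))))

  ∃Proper? : ∀ {m} T → Dec (∃ (Proper {m} T))
  ∃Proper? T = map′ (λ (i , proper) → finToFun i , proper)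
                    (λ (c , proper) → funToFin c , Proper-cong (≡.sym ∘ finToFun-funToFin c) proper)
                    (any? λ i → proper? T (finToFun i))

  Proper⇒Colorable : ∀ {m T} {c : Fin n → Fin m} → Proper T c → Colorable G T m
  Proper⇒Colorable {c = c} proper = (λ v _ → c v) , λ u∈T v∈T → proper _ _ u∈T v∈T

  Colorable⇒Proper : ∀ {m T} → Colorable G T (suc m) → ∃ (Proper T)
  Colorable⇒Proper {T = T} (c , proper) = total , proper′
    where
    colourOf : ∀ v → Dec (v ∈ T) → Fin _
    colourOf v (yes v∈T) = c v v∈T
    colourOf v (no _)    = zero
    total : Fin n → Fin _
    total v = colourOf v (v ∈? T)
    proper′ : Proper T total
    proper′ u v u∈T v∈T with u ∈? T | v ∈? T
    ... | yes u∈T′ | yes v∈T′ = proper u∈T′ v∈T′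
    ... | no u∉T   | _        = contradiction u∈T u∉T
    ... | _        | no v∉T   = contradiction v∈T v∉T

  colorable? : ∀ T m → Dec (Colorable G T m)
  colorable? T zero with nonempty? T
  ... | yes (v , v∈T) = no λ (c , _) → ¬Fin0 (c v v∈T)
  ... | no empty =
    yes ((λ v v∈T → contradiction (v , v∈T) empty) , λ u∈T → contradiction (_ , u∈T) empty)
  colorable? T (suc m) = map′ (Proper⇒Colorable ∘ proj₂) Colorable⇒Proper (∃Proper? T)

  Colorable-n : ∀ T → Colorable G T n
  Colorable-n T = Proper⇒Colorable {c = λ v → v}
    λ u v _ _ uv u≡v → irrefl G (subst (Adj G u) (≡.sym u≡v) uv)

  Colorable-≤ : ∀ {T m m′} → m ≤ m′ → Colorable G T m → Colorable G T m′
  Colorable-≤ m≤m′ (c , proper) = (λ v v∈T → inject≤ (c v v∈T) m≤m′) ,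
    λ u∈T v∈T uv → proper u∈T v∈T uv ∘ inject≤-injective m≤m′ m≤m′ _ _

  Colorable-⊆ : ∀ {A B m} → A ⊆ B → Colorable G B m → Colorable G A m
  Colorable-⊆ A⊆B (c , proper) = (λ v → c v ∘ A⊆B) , λ u∈A v∈A → proper (A⊆B u∈A) (A⊆B v∈A)

  chromNum : ∀ T → ∃ (ChromNum G T)
  chromNum T = least (colorable? T) (Colorable-n T)

  ¬Colorable⇒ChromGt : ∀ {T m} → ¬ Colorable G T m → ChromGt G T m
  ¬Colorable⇒ChromGt {T} ¬col with chromNum T
  ... | χ , χT@(col , _) = χ , χT , ≰⇒> λ χ≤m → ¬col (Colorable-≤ χ≤m col)

  MaxChromSubset⇒¬Colorable : ∀ {m M T T′} → MaxChromSubset G m M T → M ⊂ T′ → T′ ⊆ T →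
                              ¬ Colorable G T′ m
  MaxChromSubset⇒¬Colorable (_ , _ , maximal) M⊂T′ T′⊆T col with maximal _ M⊂T′ T′⊆T
  ... | _ , (_ , minimal) , m<χ = <⇒≱ m<χ (minimal _ col)

  module _ {A J : Subset n} (indJ : Independent G J) where

    private
      x∈A∪J∧x∉J⇒x∈A : ∀ {x} → x ∈ A ∪ J → x ∉ J → x ∈ A
      x∈A∪J∧x∉J⇒x∈A x∈ x∉J = [ (λ x∈A → x∈A) , (λ x∈J → contradiction x∈J x∉J) ]′ (x∈p∪q⁻ A J x∈)

    Colorable-∪-Independent-unused : ∀ {m} (col : Colorable G A m) {j} →
                                     (∀ {v} (v∈A : v ∈ A) → proj₁ col v v∈A ≢ j) →
                                     Colorable G (A ∪ J) m
    Colorable-∪-Independent-unused {m} (c , proper) {j} unused =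
      (λ v v∈ → colour v v∈ (v ∈? J)) , proper′
      where
      colour : ∀ v → v ∈ A ∪ J → Dec (v ∈ J) → Fin m
      colour v _  (yes _)  = j
      colour v v∈ (no v∉J) = c v (x∈A∪J∧x∉J⇒x∈A v∈ v∉J)
      proper′ : ∀ {u v} (u∈ : u ∈ A ∪ J) (v∈ : v ∈ A ∪ J) → Adj G u v →
                colour u u∈ (u ∈? J) ≢ colour v v∈ (v ∈? J)
      proper′ {u} {v} u∈ v∈ uv with u ∈? J | v ∈? J
      ... | yes u∈J | yes v∈J = contradiction uv (indJ u∈J v∈J)
      ... | yes _   | no v∉J  = unused (x∈A∪J∧x∉J⇒x∈A v∈ v∉J) ∘ ≡.sym
      ... | no u∉J  | yes _   = unused (x∈A∪J∧x∉J⇒x∈A u∈ u∉J)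
      ... | no u∉J  | no v∉J  = proper (x∈A∪J∧x∉J⇒x∈A u∈ u∉J) (x∈A∪J∧x∉J⇒x∈A v∈ v∉J) uv

    Colorable-∪-Independent : ∀ {m} → Colorable G A m → Colorable G (A ∪ J) (suc m)
    Colorable-∪-Independent (c , proper) = Colorable-∪-Independent-unused
      ((λ v v∈A → suc (c v v∈A)) , λ u∈A v∈A uv → proper u∈A v∈A uv ∘ suc-injective)
      {zero} λ _ ()

  Proper⇒Independent[T∩c⁻¹[j]] : ∀ {m T j} {c : Fin n → Fin m} → Proper T c →
                                 Independent G (T ∩ c ⁻¹[ j ])
  Proper⇒Independent[T∩c⁻¹[j]] {T = T} {c = c} proper u∈ v∈ uv
    with x∈p∩q⁻ T _ u∈ | x∈p∩q⁻ T _ v∈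
  ... | u∈T , u∈c⁻¹[j] | v∈T , v∈c⁻¹[j] = proper _ _ u∈T v∈T uv
    (trans (x∈c⁻¹[j]⇒cx≡j {c = c} u∈c⁻¹[j]) (≡.sym (x∈c⁻¹[j]⇒cx≡j {c = c} v∈c⁻¹[j])))

module _ {n : ℕ} (G : Graph n) {k : ℕ} {M : Subset n} where

  mkGoodPartition : ChromNum G M (suc k) → ∀ {S I} → S ∪ I ≡ M → Empty (S ∩ I) →
                    Colorable G S k → Independent G I → GoodPartition G k M S I
  mkGoodPartition (_ , minimal) S∪I≡M S∩I-empty colS indI =
    S∪I≡M , S∩I-empty , (colS , lowerBound) , indI
    where
    lowerBound : ∀ m → Colorable G _ m → k ≤ m
    lowerBound m col = ≤-pred (minimal (suc m)
      (subst (λ T → Colorable G T (suc m)) S∪I≡M (Colorable-∪-Independent G indI col)))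

module _ {n : ℕ} (G : Graph n) {k : ℕ} {M S I : Subset n}
         (maxM : MaxChromSubset G (suc k) M ⊤) (good : GoodPartition G k M S I) where

  private
    χM : ChromNum G M (suc k)
    χM = proj₁ (proj₂ maxM)

    S∪I≡M : S ∪ I ≡ M
    S∪I≡M = proj₁ good

    χS : ChromNum G S k
    χS = proj₁ (proj₂ (proj₂ good))

    indI : Independent G I
    indI = proj₂ (proj₂ (proj₂ good))

    x∈S⇒x∉I : ∀ {x} → x ∈ S → x ∉ I
    x∈S⇒x∉I x∈S x∈I = proj₁ (proj₂ good) (_ , x∈p∩q⁺ (x∈S , x∈I))

    S∪I⊂⇒¬Colorable : ∀ {A J} → S ∪ I ⊂ A ∪ J → Independent G J → ¬ Colorable G A k
    S∪I⊂⇒¬Colorable S∪I⊂A∪J indJ col = MaxChromSubset⇒¬Colorable G maxM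
      (subst (_⊂ _) S∪I≡M S∪I⊂A∪J) ⊆⊤ (Colorable-∪-Independent G indJ col)

  I-maximalIndependent : MaxIndepSubset G I (∁ S)
  I-maximalIndependent = I⊆∁S , indI , extend
    where
    I⊆∁S : I ⊆ ∁ S
    I⊆∁S x∈I = x∉p⇒x∈∁p λ x∈S → x∈S⇒x∉I x∈S x∈I
    extend : ∀ J → I ⊂ J → J ⊆ ∁ S → ¬ Independent G J
    extend J (I⊆J , v , v∈J , v∉I) J⊆∁S indJ = S∪I⊂⇒¬Colorable
      (∪-⊂-∪ ⊆-refl I⊆J (x∈p∪q⁺ (inj₂ v∈J)) (x∈∁p⇒x∉p (J⊆∁S v∈J)) v∉I) indJ (proj₁ χS)

  colourClassExchange : ∀ {c : Fin n → Fin k} → Proper G S c → ∀ j →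
                        GoodPartition G k M ((S ─ (S ∩ c ⁻¹[ j ])) ∪ I) (S ∩ c ⁻¹[ j ])
  colourClassExchange {c} proper j =
    mkGoodPartition G χM union disjoint colourable (Proper⇒Independent[T∩c⁻¹[j]] G {c = c} proper)
    where
    C : Subset n
    C = S ∩ c ⁻¹[ j ]
    union : ((S ─ C) ∪ I) ∪ C ≡ M
    union = begin
      ((S ─ C) ∪ I) ∪ C  ≡⟨ ∪-assoc (S ─ C) I C ⟩
      (S ─ C) ∪ (I ∪ C)  ≡⟨ cong ((S ─ C) ∪_) (∪-comm I C) ⟩
      (S ─ C) ∪ (C ∪ I)  ≡⟨ ∪-assoc (S ─ C) C I ⟨
      ((S ─ C) ∪ C) ∪ I  ≡⟨ cong (_∪ I) (p─q∪q≡p (p∩q⊆p S _)) ⟩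
      S ∪ I              ≡⟨ S∪I≡M ⟩
      M                  ∎
      where open ≡.≡-Reasoning
    disjoint : Empty (((S ─ C) ∪ I) ∩ C)
    disjoint (x , x∈) with x∈p∩q⁻ _ C x∈
    ... | x∈S─C∪I , x∈C with x∈p∪q⁻ (S ─ C) I x∈S─C∪I
    ... | inj₁ x∈S─C = x∈p─q⇒x∉q x∈S─C x∈C
    ... | inj₂ x∈I   = x∈S⇒x∉I (p∩q⊆p S _ x∈C) x∈I
    colourable : Colorable G ((S ─ C) ∪ I) k
    colourable = Colorable-∪-Independent-unused G indI
      (Colorable-⊆ G (p─q⊆p S C) (Proper⇒Colorable G {c = c} proper))
      λ v∈S─C cv≡j → x∈p─q⇒x∉q v∈S─C (x∈p∩q⁺ (p─q⊆p S C v∈S─C , cx≡j⇒x∈c⁻¹[j] {c = c} cv≡j))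

  vertexExchange : ∀ {v} → v ∈ I → Colorable G (S ∪ ⁅ v ⁆) k →
                   GoodPartition G k M (S ∪ ⁅ v ⁆) (I - v)
  vertexExchange {v} v∈I col = mkGoodPartition G χM union disjoint col
    (λ x∈ y∈ → indI (p─q⊆p I _ x∈) (p─q⊆p I _ y∈))
    where
    ⁅v⁆⊆I : ⁅ v ⁆ ⊆ I
    ⁅v⁆⊆I x∈⁅v⁆ = subst (_∈ I) (≡.sym (x∈⁅y⁆⇒x≡y v x∈⁅v⁆)) v∈I
    union : (S ∪ ⁅ v ⁆) ∪ (I - v) ≡ M
    union = begin
      (S ∪ ⁅ v ⁆) ∪ (I - v)  ≡⟨ ∪-assoc S ⁅ v ⁆ (I - v) ⟩
      S ∪ (⁅ v ⁆ ∪ (I - v))  ≡⟨ cong (S ∪_) (∪-comm ⁅ v ⁆ (I - v)) ⟩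
      S ∪ ((I - v) ∪ ⁅ v ⁆)  ≡⟨ cong (S ∪_) (p─q∪q≡p ⁅v⁆⊆I) ⟩
      S ∪ I                  ≡⟨ S∪I≡M ⟩
      M                      ∎
      where open ≡.≡-Reasoning
    disjoint : Empty ((S ∪ ⁅ v ⁆) ∩ (I - v))
    disjoint (x , x∈) with x∈p∩q⁻ (S ∪ ⁅ v ⁆) _ x∈
    ... | x∈S∪⁅v⁆ , x∈I-v with x∈p∪q⁻ S ⁅ v ⁆ x∈S∪⁅v⁆
    ... | inj₁ x∈S   = x∈S⇒x∉I x∈S (p─q⊆p I _ x∈I-v)
    ... | inj₂ x∈⁅v⁆ = x∈p─q⇒x∉q x∈I-v x∈⁅v⁆

  module _ (maximum : ∀ S′ I′ → GoodPartition G k M S′ I′ → ∣ S′ ∣ ≤ ∣ S ∣) where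

    I-bound : ∀ {c : Fin n → Fin k} → Proper G S c → k * ∣ I ∣ ≤ ∣ S ∣
    I-bound {c} proper =
      subst (k * ∣ I ∣ ≤_) (≡.sym (∣p∣≡∑∣p∩c⁻¹[j]∣ S c)) (*≤∑ _ classBound)
      where
      classBound : ∀ j → ∣ I ∣ ≤ ∣ S ∩ c ⁻¹[ j ] ∣
      classBound j = +-cancelˡ-≤ ∣ S ─ C ∣ _ _ (begin
        ∣ S ─ C ∣ + ∣ I ∣  ≡⟨ ∣p∪q∣≡∣p∣+∣q∣ (S ─ C) I S─C∩I-empty ⟨
        ∣ (S ─ C) ∪ I ∣    ≤⟨ maximum _ _ (colourClassExchange proper j) ⟩
        ∣ S ∣              ≡⟨ ∣p─q∣+∣q∣≡∣p∣ (p∩q⊆p S _) ⟨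
        ∣ S ─ C ∣ + ∣ C ∣  ∎)
        where
        open ≤-Reasoning
        C : Subset n
        C = S ∩ c ⁻¹[ j ]
        S─C∩I-empty : Empty ((S ─ C) ∩ I)
        S─C∩I-empty (x , x∈) with x∈p∩q⁻ (S ─ C) I x∈
        ... | x∈S─C , x∈I = x∈S⇒x∉I (p─q⊆p S C x∈S─C) x∈I

    S-maximalChromatic : MaxChromSubset G k S ⊤
    S-maximalChromatic = ⊆⊤ , χS , λ S′ S⊂S′ _ → ¬Colorable⇒ChromGt G (¬Colorable S⊂S′)
      where
      ¬Colorable : ∀ {S′} → S ⊂ S′ → ¬ Colorable G S′ k
      ¬Colorable {S′} (S⊆S′ , v , v∈S′ , v∉S) col with v ∈? I
      ... | no v∉I  = S∪I⊂⇒¬Colorable (∪-⊂-∪ S⊆S′ ⊆-refl (x∈p∪q⁺ (inj₁ v∈S′)) v∉S v∉I) indI col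
      ... | yes v∈I = <⇒≱ (p⊂q⇒∣p∣<∣q∣ S⊂S∪⁅v⁆)
                          (maximum _ _ (vertexExchange v∈I (Colorable-⊆ G S∪⁅v⁆⊆S′ col)))
        where
        S⊂S∪⁅v⁆ : S ⊂ S ∪ ⁅ v ⁆
        S⊂S∪⁅v⁆ = p⊆p∪q ⁅ v ⁆ , v , x∈p∪q⁺ (inj₂ (x∈⁅x⁆ v)) , v∉S
        S∪⁅v⁆⊆S′ : S ∪ ⁅ v ⁆ ⊆ S′
        S∪⁅v⁆⊆S′ = [ S⊆S′ , (λ x∈⁅v⁆ → subst (_∈ S′) (≡.sym (x∈⁅y⁆⇒x≡y v x∈⁅v⁆)) v∈S′) ]′
                   ∘ x∈p∪q⁻ S ⁅ v ⁆

lemma4 : ∀ {n : ℕ} (G : Graph n) (k : ℕ) → 1 ≤ k →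
    (M S I : Subset n) →
    MaxChromSubset G (k + 1) M ⊤ →
    GoodPartition G k M S I →
    (∀ S′ I′ → GoodPartition G k M S′ I′ → ∣ S′ ∣ ≤ ∣ S ∣) →
    MaxIndepSubset G I (∁ S) × k * ∣ I ∣ ≤ ∣ S ∣ × MaxChromSubset G k S ⊤
-- 1 ≤ k supplies the default colour needed to turn the colouring of S into a total one.
lemma4 G (suc k) _ M S I maxM good@(_ , _ , (colS , _) , _) maximum =
    I-maximalIndependent G maxM′ good
  , I-bound G maxM′ good maximum (proj₂ (Colorable⇒Proper G colS))
  , S-maximalChromatic G maxM′ good maximum
  where
  maxM′ : MaxChromSubset G (suc (suc k)) M ⊤
  maxM′ = subst (λ m → MaxChromSubset G m M ⊤) (+-comm (suc k) 1) maxM
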